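{- Let $\Gamma$ be a finite group acting faithfully on a set $X$, and let every subgroup of $\Gamma$ act on $X$ by the restriction of the action of $\Gamma$. Let $H_1,\ldots,H_k$ be all the maximal nonidentity subgroups of $\Gamma$, and suppose $\max\{D_{H_i}(X)\}_{i=1}^{k}=c$. Then $D_{\Gamma}(X)\leq c+1$.
   Context: For a group $G$ acting faithfully on a set $X$, an $r$-labeling of $X$ is a surjective map $\phi:X\to\{1,\ldots,r\}$; an element $g\in G$ preserves $\phi$ if $\phi(g.x)=\phi(x)$ for all $x\in X$; $\phi$ is distinguishing if the only element of $G$ preserving $\phi$ is the identity. The distinguishing number $D_G(X)$ is the least $r$ for which a distinguishing $r$-labeling of $X$ exists. Throughout, group actions are assumed faithful. -}

module Defs where

open import Level using (0ℓ)
open import Algebra.Bundles using (Group)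
open import Data.Nat using (ℕ; _≤_)
open import Data.Fin using (Fin)
open import Data.Product using (Σ; ∃; _×_; _,_)
open import Relation.Nullary using (¬_)
open import Relation.Binary.PropositionalEquality using (_≡_)

module _ (Γ : Group 0ℓ 0ℓ) where
  open Group Γ

  IsFiniteGroup : Set
  IsFiniteGroup = Σ ℕ λ n → Σ (Fin n → Carrier) λ f → ∀ g → ∃ λ i → f i ≈ g

  record Action (X : Set) : Set where
    field
      act       : Carrier → X → X
      act-resp  : ∀ {g h} → g ≈ h → ∀ x → act g x ≡ act h x
      act-ε     : ∀ x → act ε x ≡ x
      act-∙     : ∀ g h x → act (g ∙ h) x ≡ act g (act h x)

  module _ {X : Set} (A : Action X) where
    open Action A

    Faithful : Set
    Faithful = ∀ g → (∀ x → act g x ≡ x) → g ≈ ε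

    record IsSubgroup (H : Carrier → Set) : Set where
      field
        resp  : ∀ {g h} → g ≈ h → H g → H h
        ε∈    : H ε
        ∙∈    : ∀ {g h} → H g → H h → H (g ∙ h)
        ⁻¹∈   : ∀ {g} → H g → H (g ⁻¹)

    -- An r-labeling of X: a surjective map X → {1,…,r} (labels = Fin r).
    Surjective : {r : ℕ} → (X → Fin r) → Set
    Surjective {r} φ = ∀ (i : Fin r) → ∃ λ x → φ x ≡ i

    Preserves : {r : ℕ} → Carrier → (X → Fin r) → Set
    Preserves g φ = ∀ x → φ (act g x) ≡ φ x

    Distinguishing : (H : Carrier → Set) → {r : ℕ} → (X → Fin r) → Set
    Distinguishing H φ = ∀ g → H g → Preserves g φ → g ≈ ε

    HasDistLabeling : (H : Carrier → Set) → ℕ → Set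
    HasDistLabeling H r = Σ (X → Fin r) λ φ → Surjective φ × Distinguishing H φ

    IsDistNumber : (H : Carrier → Set) → ℕ → Set
    IsDistNumber H d = HasDistLabeling H d × (∀ r → HasDistLabeling H r → d ≤ r)

  Whole : Carrier → Set
  Whole _ = Data.Unit.⊤
    where import Data.Unit

  Proper : (Carrier → Set) → Set
  Proper H = ∃ λ g → ¬ H g

  Nontrivial : (Carrier → Set) → Set
  Nontrivial H = ∃ λ g → H g × ¬ (g ≈ ε)

  IsMaximalNonidentity : {X : Set} → Action X → (Carrier → Set) → Set₁
  IsMaximalNonidentity A H =
    IsSubgroup A H × Proper H × Nontrivial H ×
    (∀ (K : Carrier → Set) → IsSubgroup A K → Proper K → (∀ g → H g → K g) → ∀ g → K g → H g)

-- Take a maximal nonidentity subgroup H₀, a distinguishing labeling φ₀ of it, and a point x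
-- whose φ₀-label is changed by some h ∈ H₀. The g for which g x and x get the same φ₀-labels
-- under every further translation form a subgroup K with h ∉ K, so K lies in a maximal
-- nonidentity subgroup M. Give one new label to the points that look like x both for φ₀ and
-- for a distinguishing labeling φ of M: an element preserving the result maps x into K ⊆ M
-- and preserves φ, hence is trivial. Finiteness makes labels of orbits decidable; the maximal
-- subgroups are found in the double-negation monad, which is harmless since d ≤ suc c is
-- decidable.
module Submission where

open import Defs
open import Level using (0ℓ)
open import Algebra.Bundles using (Group)
open import Data.Nat using (ℕ; _≤_; suc; s≤s; _≤?_)
open import Data.Nat.Properties using (≤-refl; ≤-trans; n≤1+n)
open import Data.Fin using (Fin; zero; suc)
open import Data.Fin.Properties using (all?; _≟_; suc-injective)
open import Data.Fin.Subset using (Subset; _∈_; _⊆_; _⊂_; _⊃_; _⊄_)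
open import Data.Fin.Subset.Properties using (_∈?_; p⊂q⇒p⊆q)
open import Data.Fin.Subset.Induction using (⊃-wellFounded)
open import Data.Product using (∃; _×_; _,_; proj₁)
open import Data.Vec using (tabulate)
open import Data.Vec.Properties using (lookup⇒[]=; []=⇒lookup; lookup∘tabulate)
open import Function using (_∘_)
open import Induction.WellFounded using (Acc; acc)
open import Relation.Binary.PropositionalEquality
  using (_≡_; _≢_; refl; sym; trans; cong; module ≡-Reasoning)
open import Relation.Nullary using (¬_; Dec; yes; no; does; Stable; contradiction)
open import Relation.Nullary.Decidable using (map′; _×-dec_; decidable-stable; dec-true; ¬¬-excluded-middle)
open import Relation.Nullary.Negation using (¬¬-map; negated-stable)
open import Relation.Unary using (Decidable)

-- The double-negation monad, with a bind between different universe levels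
-- (the standard library's ¬¬-Monad is level-homogeneous).
private
  _>>=_ : ∀ {a b} {A : Set a} {B : Set b} → ¬ ¬ A → (A → ¬ ¬ B) → ¬ ¬ B
  ¬¬a >>= k = negated-stable (¬¬-map k ¬¬a)

  return : ∀ {a} {A : Set a} → A → ¬ ¬ A
  return a ¬a = ¬a a

¬¬-Decidable : ∀ {n} (P : Fin n → Set) → ¬ ¬ Decidable P
¬¬-Decidable {ℕ.zero} P = return λ ()
¬¬-Decidable {suc n} P = do
  P₀? ← ¬¬-excluded-middle
  Pₛ? ← ¬¬-Decidable (P ∘ suc)
  return λ { zero → P₀? ; (suc i) → Pₛ? i }

⊆-MaximalAbove : ∀ {n} → (Subset n → Set) → Subset n → Set
⊆-MaximalAbove P s = ∃ λ t → P t × s ⊆ t × ∀ {u} → P u → t ⊄ u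

¬¬-⊆-maximal : ∀ {n} (P : Subset n → Set) {s} → P s → ¬ ¬ ⊆-MaximalAbove P s
¬¬-⊆-maximal P = go (⊃-wellFounded _)
  where
  go : ∀ {s} → Acc _⊃_ s → P s → ¬ ¬ ⊆-MaximalAbove P s
  go {s} (acc above) Ps = do
    yes (u , Pu , s⊂u) ← ¬¬-excluded-middle {A = ∃ λ u → P u × s ⊂ u}
      where no none-above → return {A = ⊆-MaximalAbove P s}
                               (s , Ps , (λ i∈s → i∈s) , λ Pu s⊂u → none-above (_ , Pu , s⊂u))
    (t , Pt , u⊆t , t-max) ← go (above s⊂u) Pu
    return {A = ⊆-MaximalAbove P s} (t , Pt , (λ i∈s → u⊆t (p⊂q⇒p⊆q s⊂u i∈s)) , t-max)

module _ (Γ : Group 0ℓ 0ℓ) {X : Set} (A : Action Γ X) where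
  open Group Γ using (Carrier; _≈_; _∙_; ε; _⁻¹) renaming (sym to ≈-sym)
  open Action A
  open import Algebra.Properties.Group Γ using (//-rightDividesˡ)

  moves-label : ∀ {H r} {φ : X → Fin r} → Distinguishing Γ A H φ →
                ∀ {g} → H g → ¬ g ≈ ε → ¬ ¬ ∃ λ x → φ (act g x) ≢ φ x
  moves-label {φ = φ} φ-dist {g} Hg g≉ε no-moved = g≉ε (φ-dist g Hg λ x →
    decidable-stable (φ (act g x) ≟ φ x) λ ne → no-moved (x , ne))

  module _ {r : ℕ} (φ : X → Fin r) where

    Twin : X → X → Set
    Twin y z = ∀ h → φ (act h y) ≡ φ (act h z)

    twinGroup : X → Carrier → Set
    twinGroup x g = Twin (act g x) x

    twinGroup-isSubgroup : ∀ x → IsSubgroup Γ A (twinGroup x)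
    twinGroup-isSubgroup x = record
      { resp = λ {g} {g′} g≈g′ twin h → trans (cong (φ ∘ act h) (sym (act-resp g≈g′ x))) (twin h)
      ; ε∈   = λ h → cong (φ ∘ act h) (act-ε x)
      ; ∙∈   = ∙∈
      ; ⁻¹∈  = ⁻¹∈
      }
      where
      open ≡-Reasoning
      ∙∈ : ∀ {g g′} → twinGroup x g → twinGroup x g′ → twinGroup x (g ∙ g′)
      ∙∈ {g} {g′} twin twin′ h = begin
        φ (act h (act (g ∙ g′) x))  ≡⟨ cong (φ ∘ act h) (act-∙ g g′ x) ⟩
        φ (act h (act g (act g′ x))) ≡⟨ cong φ (act-∙ h g _) ⟨
        φ (act (h ∙ g) (act g′ x))  ≡⟨ twin′ (h ∙ g) ⟩
        φ (act (h ∙ g) x)           ≡⟨ cong φ (act-∙ h g x) ⟩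
        φ (act h (act g x))         ≡⟨ twin h ⟩
        φ (act h x)                 ∎
      ⁻¹∈ : ∀ {g} → twinGroup x g → twinGroup x (g ⁻¹)
      ⁻¹∈ {g} twin h = begin
        φ (act h (act (g ⁻¹) x))        ≡⟨ cong φ (act-∙ h (g ⁻¹) x) ⟨
        φ (act (h ∙ g ⁻¹) x)            ≡⟨ twin (h ∙ g ⁻¹) ⟨
        φ (act (h ∙ g ⁻¹) (act g x))    ≡⟨ cong φ (act-∙ (h ∙ g ⁻¹) g x) ⟨
        φ (act (h ∙ g ⁻¹ ∙ g) x)        ≡⟨ cong φ (act-resp (//-rightDividesˡ g h) x) ⟩
        φ (act h x)                     ∎

    twinGroup-excludes : ∀ {x g} → φ (act g x) ≢ φ x → ¬ twinGroup x g
    twinGroup-excludes {x} {g} gx≢x twin = gx≢x (begin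
      φ (act g x)           ≡⟨ cong φ (act-ε (act g x)) ⟨
      φ (act ε (act g x))   ≡⟨ twin ε ⟩
      φ (act ε x)           ≡⟨ cong φ (act-ε x) ⟩
      φ x                   ∎)
      where open ≡-Reasoning

  -- The new label 0 goes to the points that look like x to both R and φ. An element
  -- preserving the new labeling sends x to such a point, so lies in H, and preserves φ.
  module _ {H : Carrier → Set} {d : ℕ} (φ : X → Fin d)
           (φ-surj : Surjective Γ A φ) (φ-dist : Distinguishing Γ A H φ)
           (R : X → Set) (R? : Decidable R) (x : X) (Rx : R x)
           (R⇒H : ∀ g → R (act g x) → H g) where

    private
      Marked : X → Set
      Marked y = R y × φ y ≡ φ x

      Marked? : Decidable Marked
      Marked? y = R? y ×-dec (φ y ≟ φ x)

      marked : X → Fin (suc d)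
      marked y with Marked? y
      ... | yes _ = zero
      ... | no  _ = suc (φ y)

      marked-zero : ∀ {y} → Marked y → marked y ≡ zero
      marked-zero {y} My with Marked? y
      ... | yes _  = refl
      ... | no ¬My = contradiction My ¬My

      marked-suc : ∀ {y} → ¬ Marked y → marked y ≡ suc (φ y)
      marked-suc {y} ¬My with Marked? y
      ... | yes My = contradiction My ¬My
      ... | no _   = refl

      marked-zero⁻¹ : ∀ {y} → marked y ≡ zero → Marked y
      marked-zero⁻¹ {y} eq with Marked? y
      ... | yes My = My

      marked-refines : ∀ {y z} → marked y ≡ marked z → φ y ≡ φ z
      marked-refines {y} {z} eq with Marked? y | Marked? z
      ... | yes (_ , φy) | yes (_ , φz) = trans φy (sym φz)
      ... | no _         | no _         = suc-injective eq

      marked-surjective : (∃ λ z → φ z ≡ φ x × ¬ R z) → Surjective Γ A marked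
      marked-surjective _ zero = x , marked-zero (Rx , refl)
      marked-surjective (z , φz , ¬Rz) (suc j) with φ-surj j
      ... | y , refl with Marked? y
      ...   | no ¬My = y , marked-suc ¬My
      ...   | yes (_ , φy) = z , trans (marked-suc (¬Rz ∘ proj₁)) (cong suc (trans φz (sym φy)))

      marked-distinguishing : Distinguishing Γ A (Whole Γ) marked
      marked-distinguishing g _ g-pres = φ-dist g (R⇒H g R[gx]) (λ y → marked-refines (g-pres y))
        where
        R[gx] : R (act g x)
        R[gx] = proj₁ (marked-zero⁻¹ (trans (g-pres x) (marked-zero (Rx , refl))))

      φ-distinguishing : ¬ (∃ λ z → φ z ≡ φ x × ¬ R z) → Distinguishing Γ A (Whole Γ) φ
      φ-distinguishing no-z g _ g-pres = φ-dist g (R⇒H g R[gx]) g-pres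
        where
        R[gx] : R (act g x)
        R[gx] = decidable-stable (R? (act g x)) λ ¬R → no-z (act g x , g-pres x , ¬R)

    -- If every point labelled φ x satisfies R, marking would empty the label suc (φ x);
    -- but then φ itself already distinguishes Γ.
    hasDistLabeling-≤suc : ¬ ¬ ∃ λ r → r ≤ suc d × HasDistLabeling Γ A (Whole Γ) r
    hasDistLabeling-≤suc = do
      yes z ← ¬¬-excluded-middle
        where no no-z → return (d , n≤1+n d , φ , φ-surj , φ-distinguishing no-z)
      return (suc d , ≤-refl , marked , marked-surjective z , marked-distinguishing)

  module _ {n : ℕ} (f : Fin n → Carrier) (enum : ∀ g → ∃ λ i → f i ≈ g) where

    Twin? : ∀ {r} (φ : X → Fin r) → ∀ y z → Dec (Twin φ y z)
    Twin? φ y z = map′ fromEnum (λ twin i → twin (f i)) (all? λ i → φ (act (f i) y) ≟ φ (act (f i) z))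
      where
      fromEnum : (∀ i → φ (act (f i) y) ≡ φ (act (f i) z)) → Twin φ y z
      fromEnum twin h with enum h
      ... | i , fi≈h = trans (cong φ (sym (act-resp fi≈h y))) (trans (twin i) (cong φ (act-resp fi≈h z)))

    -- Membership quantifies over all indices of g, so it respects ≈ and is ¬¬-stable.
    ⟦_⟧ : Subset n → Carrier → Set
    ⟦ s ⟧ g = ∀ {i} → f i ≈ g → i ∈ s

    ⟦⟧-stable : ∀ s g → Stable (⟦ s ⟧ g)
    ⟦⟧-stable s g ¬¬g∈s {i} fi≈g = decidable-stable (i ∈? s) (¬¬-map (λ g∈s → g∈s fi≈g) ¬¬g∈s)

    Saturated : Subset n → Set
    Saturated s = ∀ {i} → i ∈ s → ⟦ s ⟧ (f i)

    module _ {Q : Carrier → Set} (Q-resp : ∀ {g h} → g ≈ h → Q g → Q h) (Q? : Decidable (Q ∘ f)) where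

      subsetOf : Subset n
      subsetOf = tabulate (does ∘ Q?)

      ∈-subsetOf⁺ : ∀ {i} → Q (f i) → i ∈ subsetOf
      ∈-subsetOf⁺ {i} Qfi = lookup⇒[]= i subsetOf (trans (lookup∘tabulate (does ∘ Q?) i) (dec-true (Q? i) Qfi))

      ∈-subsetOf⁻ : ∀ {i} → i ∈ subsetOf → Q (f i)
      ∈-subsetOf⁻ {i} i∈ with Q? i | trans (sym (lookup∘tabulate (does ∘ Q?) i)) ([]=⇒lookup i∈)
      ... | yes Qfi | _ = Qfi

      ⟦subsetOf⟧⁺ : ∀ {g} → Q g → ⟦ subsetOf ⟧ g
      ⟦subsetOf⟧⁺ Qg fi≈g = ∈-subsetOf⁺ (Q-resp (≈-sym fi≈g) Qg)

      ⟦subsetOf⟧⁻ : ∀ {g} → ⟦ subsetOf ⟧ g → Q g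
      ⟦subsetOf⟧⁻ {g} g∈ with enum g
      ... | i , fi≈g = Q-resp fi≈g (∈-subsetOf⁻ (g∈ fi≈g))

    module _ (K : Carrier → Set) where

      ProperAbove : Subset n → Set
      ProperAbove s = IsSubgroup Γ A ⟦ s ⟧ × Proper Γ ⟦ s ⟧ × (∀ g → K g → ⟦ s ⟧ g) × Saturated s

      properAbove-subsetOf : ∀ {Q} (Q-sub : IsSubgroup Γ A Q) → Proper Γ Q → (∀ g → K g → Q g) →
                             (Q? : Decidable (Q ∘ f)) → ProperAbove (subsetOf (IsSubgroup.resp Q-sub) Q?)
      properAbove-subsetOf {Q} Q-sub (g , ¬Qg) K⊆Q Q? =
        record { resp = λ e → ⁺ ∘ resp e ∘ ⁻ ; ε∈ = ⁺ ε∈ ; ∙∈ = λ a b → ⁺ (∙∈ (⁻ a) (⁻ b)) ; ⁻¹∈ = ⁺ ∘ ⁻¹∈ ∘ ⁻ }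
        , (g , ¬Qg ∘ ⁻) , (λ h → ⁺ ∘ K⊆Q h) , ⟦subsetOf⟧⁺ resp Q? ∘ ∈-subsetOf⁻ resp Q?
        where
        open IsSubgroup Q-sub
        ⁺ : ∀ {g} → Q g → ⟦ subsetOf resp Q? ⟧ g
        ⁺ = ⟦subsetOf⟧⁺ resp Q?
        ⁻ : ∀ {g} → ⟦ subsetOf resp Q? ⟧ g → Q g
        ⁻ = ⟦subsetOf⟧⁻ resp Q?

      maximal-properAbove : ∀ {t} → ProperAbove t → (∀ {u} → ProperAbove u → t ⊄ u) → Nontrivial Γ K →
                            IsMaximalNonidentity Γ A ⟦ t ⟧
      maximal-properAbove {t} t-above@(t-sub , t-proper , K⊆t , t-sat) t-max (h , Kh , h≉ε) =
        t-sub , t-proper , (h , K⊆t h Kh , h≉ε) , maximal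
        where
        maximal : ∀ L → IsSubgroup Γ A L → Proper Γ L → (∀ g → ⟦ t ⟧ g → L g) → ∀ g → L g → ⟦ t ⟧ g
        maximal L L-sub L-proper t⊆L g Lg = ⟦⟧-stable t g do
          L? ← ¬¬-Decidable (L ∘ f)
          let open IsSubgroup L-sub using (resp)
              u : Subset n
              u = subsetOf resp L?
              t⊆u : t ⊆ u
              t⊆u i∈t = ∈-subsetOf⁺ resp L? (t⊆L _ (t-sat i∈t))
              u⊆t : u ⊆ t
              u⊆t {i} i∈u = decidable-stable (i ∈? t) λ i∉t →
                t-max (properAbove-subsetOf L-sub L-proper (λ g → t⊆L g ∘ K⊆t g) L?) (t⊆u , i , i∈u , i∉t)
          return λ {_} fi≈g → u⊆t (⟦subsetOf⟧⁺ resp L? Lg fi≈g)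

    maximal-above : ∀ {K} → IsSubgroup Γ A K → Proper Γ K → Nontrivial Γ K →
                    ¬ ¬ ∃ λ M → IsMaximalNonidentity Γ A M × (∀ g → K g → M g) × (∀ g → Stable (M g))
    maximal-above {K} K-sub K-proper K-nontrivial = do
      K? ← ¬¬-Decidable (K ∘ f)
      (t , t-above@(_ , _ , K⊆t , _) , _ , t-max) ←
        ¬¬-⊆-maximal (ProperAbove K) (properAbove-subsetOf K K-sub K-proper (λ _ Kg → Kg) K?)
      return (⟦ t ⟧ , maximal-properAbove K t-above t-max K-nontrivial , K⊆t , ⟦⟧-stable t)

    -- When K is trivial the given H lies above it only up to ¬¬, so we pass to a
    -- maximal subgroup above H whose membership is ¬¬-stable.
    proper-⊆-maximal : ∀ {K} → IsSubgroup Γ A K → Proper Γ K → (∃ λ H → IsMaximalNonidentity Γ A H) →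
                       ¬ ¬ ∃ λ M → IsMaximalNonidentity Γ A M × (∀ g → K g → M g)
    proper-⊆-maximal {K} K-sub K-proper (H , H-sub , H-proper , H-nontrivial , _) = do
      yes K-nontrivial ← ¬¬-excluded-middle
        where no K-trivial → do
                (M , M-max@(M-sub , _) , _ , M-stable) ← maximal-above H-sub H-proper H-nontrivial
                let open IsSubgroup M-sub using (resp; ε∈)
                    K⊆M : ∀ g → K g → M g
                    K⊆M g Kg = M-stable g λ ¬Mg → K-trivial (g , Kg , λ g≈ε → ¬Mg (resp (≈-sym g≈ε) ε∈))
                return (M , M-max , K⊆M)
      (M , M-max , K⊆M , _) ← maximal-above K-sub K-proper K-nontrivial
      return (M , M-max , K⊆M)

    distinguishing-bound : ∀ c → (∃ λ H → IsMaximalNonidentity Γ A H) →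
                           (∀ H → IsMaximalNonidentity Γ A H → ∃ λ r → r ≤ c × HasDistLabeling Γ A H r) →
                           ¬ ¬ ∃ λ r → r ≤ suc c × HasDistLabeling Γ A (Whole Γ) r
    distinguishing-bound c (H₀ , H₀-max@(_ , _ , (h , H₀h , h≉ε) , _)) bounded = do
      let (_ , _ , (φ₀ , _ , φ₀-dist)) = bounded H₀ H₀-max
      (x , hx≢x) ← moves-label φ₀-dist H₀h h≉ε
      (M , M-max , twins⊆M) ←
        proper-⊆-maximal (twinGroup-isSubgroup φ₀ x) (h , twinGroup-excludes φ₀ hx≢x) (H₀ , H₀-max)
      let (d , d≤c , (φ , φ-surj , φ-dist)) = bounded M M-max
      (r , r≤1+d , marked) ← hasDistLabeling-≤suc φ φ-surj φ-dist
                               (λ y → Twin φ₀ y x) (λ y → Twin? φ₀ y x) x (λ _ → refl) twins⊆M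
      return (r , ≤-trans r≤1+d (s≤s d≤c) , marked)

-- Neither faithfulness nor the value of D_{H₀}(X) is needed: H₀ only witnesses
-- that a maximal nonidentity subgroup exists.
mainTheorem1 : (Γ : Group 0ℓ 0ℓ) → IsFiniteGroup Γ → {X : Set} → (A : Action Γ X) → Faithful Γ A →
    (c : ℕ) →
    (∀ H → IsMaximalNonidentity Γ A H → ∃ λ d → IsDistNumber Γ A H d) →
    (∀ H → IsMaximalNonidentity Γ A H → ∀ d → IsDistNumber Γ A H d → d ≤ c) →
    (∃ λ H → IsMaximalNonidentity Γ A H × IsDistNumber Γ A H c) →
    ∀ d → IsDistNumber Γ A (Whole Γ) d → d ≤ suc c
mainTheorem1 Γ (n , f , enum) A _ c hasDistNumber distNumber≤c (H₀ , H₀-max , _) d (_ , d-least) =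
  decidable-stable (d ≤? suc c)
    (¬¬-map (λ (r , r≤1+c , labeling) → ≤-trans (d-least r labeling) r≤1+c)
            (distinguishing-bound Γ A f enum c (H₀ , H₀-max) bounded))
  where
  bounded : ∀ H → IsMaximalNonidentity Γ A H → ∃ λ r → r ≤ c × HasDistLabeling Γ A H r
  bounded H H-max with hasDistNumber H H-max
  ... | r , r-dist = r , distNumber≤c H H-max r r-dist , proj₁ r-dist
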